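{- Let $G$ be a cube-free median graph, $z$ a vertex of $G$, and $F(x)$ a fiber of the star $\mathrm{St}(z)$. Then the total boundary $\partial^*F(x)$ is an isometric tree of $G$ with gated branches (rooted at $x$).
   Context: $d_G$ is the shortest-path distance, $I(u,v)=\{w: d_G(u,w)+d_G(w,v)=d_G(u,v)\}$. $G$ is median if $I(x,y)\cap I(y,z)\cap I(z,x)$ is a single vertex for all $x,y,z$, and cube-free if it contains no 3-cube $Q_3$. A subgraph $S$ is gated if every vertex $v$ has a vertex $v'\in V(S)$ (its gate) with $d_G(v,u)=d_G(v,v')+d_G(v',u)$ for all $u\in V(S)$, and isometric if $d_S=d_G$ on $V(S)$. The star $\mathrm{St}(z)$ is the union of all edges and squares (4-cycles) of $G$ containing $z$; it is gated. The fiber $F(x)$, $x\in\mathrm{St}(z)$, is the set of vertices whose gate in $\mathrm{St}(z)$ is $x$. Fibers $F(x),F(y)$ are neighboring if some edge joins them; $\partial_yF(x)$ is the subgraph induced by the vertices of $F(x)$ having a neighbor in $F(y)$. The total boundary $\partial^*F(x)$ is the subgraph whose vertex and edge sets are the unions of those of all $\partial_yF(x)$ over fibers $F(y)$ neighboring $F(x)$. A tree $T$ in $G$ with a distinguished root $r$ has gated branches if for every vertex $w$ of $T$ the unique $(w,r)$-path of $T$ is a gated subgraph of $G$. -}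

module Defs where

open import Data.Nat using (ℕ; zero; suc; _+_; _≤_)
open import Data.Fin using (Fin; zero; suc; fromℕ; inject₁)
open import Data.Sum using (_⊎_)
open import Data.Bool using (Bool; true; false)
open import Data.Product using (Σ; ∃; ∃-syntax; _×_; _,_)
open import Relation.Binary.PropositionalEquality using (_≡_; _≢_)
open import Relation.Nullary using (¬_)
open import Function.Definitions using (Injective)

record Graph : Set₁ where
  field
    V       : Set
    _~_     : V → V → Set
    ~-sym   : ∀ {u v} → u ~ v → v ~ u
    ~-irref : ∀ {u} → ¬ (u ~ u)

data Walk {V : Set} (R : V → V → Set) : V → V → ℕ → Set where
  nil  : ∀ {u} → Walk R u u zero
  cons : ∀ {u w v n} → R u w → Walk R w v n → Walk R u v (suc n)

Dist : {V : Set} → (V → V → Set) → V → V → ℕ → Set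
Dist R u v n = Walk R u v n × (∀ m → Walk R u v m → n ≤ m)

record Subgraph (G : Graph) : Set₁ where
  open Graph G
  field
    Vtx    : V → Set
    Edg    : V → V → Set
    edg-ok : ∀ {u v} → Edg u v → Vtx u × Vtx v × u ~ v

module _ (G : Graph) where
  open Graph G

  Connected : Set
  Connected = ∀ u v → ∃[ n ] Dist _~_ u v n

  Between : V → V → V → Set
  Between u w v = ∃[ a ] ∃[ b ] (Dist _~_ u w a × Dist _~_ w v b × Dist _~_ u v (a + b))

  InAll : V → V → V → V → Set
  InAll x y z m = Between x m y × Between y m z × Between z m x

  Median : Set
  Median = Connected ×
    (∀ x y z → Σ V λ m → InAll x y z m × (∀ m' → InAll x y z m' → m' ≡ m))

  -- no (not necessarily induced) subgraph isomorphic to the 3-cube Q₃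
  CubeFree : Set
  CubeFree = ¬ (Σ (Bool → Bool → Bool → V) λ f →
      (∀ a b c a' b' c' → f a b c ≡ f a' b' c' → a ≡ a' × b ≡ b' × c ≡ c')
    × (∀ b c → f false b c ~ f true b c)
    × (∀ a c → f a false c ~ f a true c)
    × (∀ a b → f a b false ~ f a b true))

  Square : V → V → V → V → Set
  Square z a w b = z ~ a × a ~ w × w ~ b × b ~ z × a ≢ b × z ≢ w

  -- vertex set of the star St(z): union of edges and squares containing z
  StarV : V → V → Set
  StarV z v = (v ≡ z) ⊎ ((z ~ v) ⊎ (∃[ a ] ∃[ b ] Square z a v b))

  IsGate : (V → Set) → V → V → Set
  IsGate P v v' = P v' × (∀ u → P u → Between v v' u)

  Gated : (V → Set) → Set
  Gated P = ∀ v → ∃[ v' ] IsGate P v v'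

  Fiber : V → V → V → Set
  Fiber z x v = IsGate (StarV z) v x

  BoundaryV : V → V → V → V → Set
  BoundaryV z x y v = Fiber z x v × ∃[ w ] (Fiber z y w × v ~ w)

  OtherFiber : V → V → V → Set
  OtherFiber z x y = StarV z y × y ≢ x

  -- total boundary ∂*F(x): union of the induced subgraphs ∂_y F(x)
  -- over the fibers F(y) neighbouring F(x)
  TotalBoundary : V → V → Subgraph G
  TotalBoundary z x = record
    { Vtx    = λ v → ∃[ y ] (OtherFiber z x y × BoundaryV z x y v)
    ; Edg    = λ u v → u ~ v × ∃[ y ] (OtherFiber z x y × BoundaryV z x y u × BoundaryV z x y v)
    ; edg-ok = λ { (e , y , o , bu , bv) → (y , o , bu) , (y , o , bv) , e }
    }

  module _ (S : Subgraph G) where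
    open Subgraph S

    Isometric : Set
    Isometric = ∀ u v → Vtx u → Vtx v → ∀ n → (Dist Edg u v n → Dist _~_ u v n) × (Dist _~_ u v n → Dist Edg u v n)

    Cycle : Set
    Cycle = ∃[ k ] Σ (Fin (suc (suc (suc k))) → V) λ c →
        Injective _≡_ _≡_ c
      × (∀ (i : Fin (suc (suc k))) → Edg (c (inject₁ i)) (c (suc i)))
      × Edg (c (fromℕ (suc (suc k)))) (c zero)

    IsTree : Set
    IsTree = (∀ u v → Vtx u → Vtx v → ∃[ n ] Walk Edg u v n) × ¬ Cycle

    PathIn : V → V → Set
    PathIn w r = ∃[ n ] Σ (Fin (suc n) → V) λ p →
        Injective _≡_ _≡_ p
      × p zero ≡ w × p (fromℕ n) ≡ r
      × (∀ (i : Fin n) → Edg (p (inject₁ i)) (p (suc i)))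

    PathVtx : ∀ {w r} → PathIn w r → V → Set
    PathVtx (n , p , _) v = ∃[ i ] p i ≡ v

    GatedBranches : V → Set
    GatedBranches r = ∀ w → Vtx w →
      PathIn w r × (∀ (P : PathIn w r) → Gated (PathVtx P))

module Submission where

-- In Boundary,
-- cube-freeness gives the key lemma: a vertex of ∂*F(x) has at most one neighbour
-- closer to x.  Hence geodesics towards x descend inside ∂*F(x) (isometry),
-- the farthest vertex of a cycle cannot exist (acyclicity), and every path of
-- ∂*F(x) to x is a geodesic containing the median of v, its start and x, which
-- is the gate of v (gated branches).

open import Defs
open import Data.Bool using (Bool; true; false)
open import Data.Empty using (⊥; ⊥-elim)
open import Data.Fin using (Fin; zero; suc; fromℕ; inject₁; toℕ)
open import Data.Fin.Relation.Unary.Top using (view; ‵fromℕ; ‵inject₁)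
open import Data.Fin.Properties using (toℕ-inject₁; toℕ-injective; toℕ≤pred[n])
  renaming (suc-injective to fsuc-injective)
open import Data.Nat using (ℕ; zero; suc; _+_; _≤_; _∸_; z≤n; s≤s; s≤s⁻¹)
open import Data.Nat.Properties
open import Data.Product using (Σ; _×_; _,_; proj₁; proj₂)
open import Data.Sum using (_⊎_; inj₁; inj₂)
open import Function.Definitions using (Injective)
open import Relation.Binary.PropositionalEquality
open import Relation.Nullary using (¬_; yes; no; Dec)

module _ {V : Set} {R : V → V → Set} where

  _++ʷ_ : ∀ {u v w m n} → Walk R u v m → Walk R v w n → Walk R u w (m + n)
  nil      ++ʷ W′ = W′
  cons e W ++ʷ W′ = cons e (W ++ʷ W′)

  snocʷ : ∀ {u v w n} → Walk R u v n → R v w → Walk R u w (suc n)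
  snocʷ nil        e = cons e nil
  snocʷ (cons e W) f = cons e (snocʷ W f)

  reverseʷ : (∀ {a b} → R a b → R b a) → ∀ {u v n} → Walk R u v n → Walk R v u n
  reverseʷ sym-R nil        = nil
  reverseʷ sym-R (cons e W) = snocʷ (reverseʷ sym-R W) (sym-R e)

  walk-length-0 : ∀ {u v} → Walk R u v 0 → u ≡ v
  walk-length-0 nil = refl

  walk-length-1 : ∀ {u v} → Walk R u v 1 → R u v
  walk-length-1 (cons e nil) = e

  vertex : ∀ {u v n} → Walk R u v n → Fin (suc n) → V
  vertex {u = u} W          zero    = u
  vertex (cons e W)         (suc i) = vertex W i

  vertex-last : ∀ {u v n} (W : Walk R u v n) → vertex W (fromℕ n) ≡ v
  vertex-last nil        = refl
  vertex-last (cons e W) = vertex-last W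

  vertex-step : ∀ {u v n} (W : Walk R u v n) (i : Fin n) →
    R (vertex W (inject₁ i)) (vertex W (suc i))
  vertex-step (cons e W) zero    = e
  vertex-step (cons e W) (suc i) = vertex-step W i

  prefix : ∀ {u v n} (W : Walk R u v n) (i : Fin (suc n)) → Walk R u (vertex W i) (toℕ i)
  prefix W          zero    = nil
  prefix (cons e W) (suc i) = cons e (prefix W i)

  suffix : ∀ {u v n} (W : Walk R u v n) (i : Fin (suc n)) → Walk R (vertex W i) v (n ∸ toℕ i)
  suffix W          zero    = W
  suffix (cons e W) (suc i) = suffix W i

mapʷ : ∀ {V : Set} {R R′ : V → V → Set} → (∀ {a b} → R a b → R′ a b) →
  ∀ {u v n} → Walk R u v n → Walk R′ u v n
mapʷ f nil        = nil
mapʷ f (cons e W) = cons (f e) (mapʷ f W)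

∸-telescope : ∀ {i j n} → i ≤ j → j ≤ n → (j ∸ i) + (n ∸ j) ≡ n ∸ i
∸-telescope {zero}  {j} {n} _ j≤n = m+[n∸m]≡n j≤n
∸-telescope {suc i} {suc j} {suc n} (s≤s i≤j) (s≤s j≤n) = ∸-telescope i≤j j≤n

squeeze-∸ : ∀ {i n a b} → a ≤ i → b ≤ n ∸ i → n ≤ a + b → b ≡ n ∸ i
squeeze-∸ {i} {n} {a} {b} a≤i b≤n∸i n≤a+b =
  ≤-antisym b≤n∸i (≤-trans (∸-monoʳ-≤ n a≤i) (m≤n+o⇒m∸n≤o n a n≤a+b))

sum≡1 : ∀ a {b} → a + b ≡ 1 → a ≡ 0 ⊎ b ≡ 0
sum≡1 zero                _  = inj₁ refl
sum≡1 (suc zero) {zero}   _  = inj₂ refl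
sum≡1 (suc zero) {suc _}  ()
sum≡1 (suc (suc _))       ()

sum≡2 : ∀ a {b} → a + b ≡ 2 → a ≡ 0 ⊎ (a ≡ 1 × b ≡ 1) ⊎ b ≡ 0
sum≡2 zero                     _  = inj₁ refl
sum≡2 (suc zero)               e  = inj₂ (inj₁ (refl , suc-injective e))
sum≡2 (suc (suc zero)) {zero}  _  = inj₂ (inj₂ refl)
sum≡2 (suc (suc zero)) {suc _} ()
sum≡2 (suc (suc (suc _)))      ()

n≢2+n : ∀ {n : ℕ} → n ≢ suc (suc n)
n≢2+n ()

mutual-bound : ∀ {a b e} → a + suc e ≤ suc b → b + suc e ≤ suc a → e ≡ 0 × a ≡ b
mutual-bound {a} {b} {e} h₁ h₂ = e≡0 , ≤-antisym (≤-trans (m≤m+n a e) a+e≤b) b≤a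
  where
  a+e≤b : a + e ≤ b
  a+e≤b = s≤s⁻¹ (subst (_≤ suc b) (+-suc a e) h₁)
  b≤a : b ≤ a
  b≤a = ≤-trans (m≤m+n b e) (s≤s⁻¹ (subst (_≤ suc a) (+-suc b e) h₂))
  e≡0 : e ≡ 0
  e≡0 = n≤0⇒n≡0 (+-cancelˡ-≤ a e 0 (≤-trans a+e≤b (subst (b ≤_) (sym (+-identityʳ a)) b≤a)))

argmax : ∀ {n} (f : Fin (suc n) → ℕ) → Σ (Fin (suc n)) λ i → ∀ j → f j ≤ f i
argmax {zero} f = zero , λ { zero → ≤-refl }
argmax {suc n} f with argmax (λ k → f (suc k))
... | i , max with f zero ≤? f (suc i)
...   | yes f₀≤ = suc i , λ { zero → f₀≤ ; (suc j) → max j }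
...   | no  f₀≰ = zero , λ { zero → ≤-refl ; (suc j) → ≤-trans (max j) (≰⇒≥ f₀≰) }

cycle-neighbours : ∀ {V : Set} {R : V → V → Set} k (c : Fin (suc (suc (suc k))) → V) →
  (∀ (i : Fin (suc (suc k))) → R (c (inject₁ i)) (c (suc i))) → R (c (fromℕ (suc (suc k)))) (c zero) →
  ∀ j → Σ (Fin (suc (suc (suc k)))) λ a → Σ (Fin (suc (suc (suc k)))) λ b →
    R (c a) (c j) × R (c j) (c b) × a ≢ b
cycle-neighbours k c step close zero = fromℕ (suc (suc k)) , suc zero , close , step zero , λ ()
cycle-neighbours k c step close (suc i) with view i
... | ‵fromℕ      = inject₁ (fromℕ (suc k)) , zero , step (fromℕ (suc k)) , close , λ ()
... | ‵inject₁ i′ = inject₁ (inject₁ i′) , suc (suc i′) , step (inject₁ i′) , step (suc i′) , apart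
  where
  apart : inject₁ (inject₁ i′) ≢ suc (suc i′)
  apart e = n≢2+n (trans (sym (trans (toℕ-inject₁ (inject₁ i′)) (toℕ-inject₁ i′))) (cong toℕ e))

weight : Bool → ℕ
weight false = 0
weight true  = 1

rank : Bool → Bool → ℕ
rank b c = weight b + weight c

SquareInjective : {V : Set} → (Bool → Bool → V) → Set
SquareInjective g = ∀ {b c b′ c′} → g b c ≡ g b′ c′ → b ≡ b′ × c ≡ c′

-- corners graded by a level function (level + rank constant) can only collide
-- if they have equal rank; so the square is injective once its two middle
-- corners differ
square-injective : ∀ {V : Set} (g : Bool → Bool → V) (level : V → ℕ) {k} →
  (∀ b c → level (g b c) + rank b c ≡ k) → g true false ≢ g false true → SquareInjective g
square-injective g level {k} graded middle {b} {c} {b′} {c′} eq = by-rank b c b′ c′ same-rank eq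
  where
  same-rank : rank b c ≡ rank b′ c′
  same-rank = +-cancelˡ-≡ (level (g b c)) _ _
    (trans (graded b c) (sym (subst (λ u → level u + rank b′ c′ ≡ k) (sym eq) (graded b′ c′))))
  by-rank : ∀ b c b′ c′ → rank b c ≡ rank b′ c′ → g b c ≡ g b′ c′ → b ≡ b′ × c ≡ c′
  by-rank false false false false _  _ = refl , refl
  by-rank false false false true  () _
  by-rank false false true  false () _
  by-rank false false true  true  () _
  by-rank false true  false false () _
  by-rank false true  false true  _  _ = refl , refl
  by-rank false true  true  false _  e = ⊥-elim (middle (sym e))
  by-rank false true  true  true  () _
  by-rank true  false false false () _
  by-rank true  false false true  _  e = ⊥-elim (middle e)
  by-rank true  false true  false _  _ = refl , refl
  by-rank true  false true  true  () _
  by-rank true  true  false false () _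
  by-rank true  true  false true  () _
  by-rank true  true  true  false () _
  by-rank true  true  true  true  _  _ = refl , refl

module Prism (G : Graph) where
  open Graph G

  IsSquare : (Bool → Bool → V) → Set
  IsSquare g = (∀ c → g false c ~ g true c) × (∀ b → g b false ~ g b true)

  prism-not-cube-free : (g h : Bool → Bool → V) → IsSquare g → IsSquare h → (∀ b c → g b c ~ h b c) →
    SquareInjective g → SquareInjective h → (∀ b c b′ c′ → g b c ≢ h b′ c′) → ¬ CubeFree G
  prism-not-cube-free g h (g₁ , g₂) (h₁ , h₂) rung g-inj h-inj disjoint cube-free =
    cube-free (f , f-inj , rung , (λ { false → g₁ ; true → h₁ }) , (λ { false → g₂ ; true → h₂ }))
    where
    f : Bool → Bool → Bool → V
    f false = g
    f true  = h
    f-inj : ∀ a b c a′ b′ c′ → f a b c ≡ f a′ b′ c′ → a ≡ a′ × b ≡ b′ × c ≡ c′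
    f-inj false b c false b′ c′ e = refl , g-inj e
    f-inj false b c true  b′ c′ e = ⊥-elim (disjoint b c b′ c′ e)
    f-inj true  b c false b′ c′ e = ⊥-elim (disjoint b′ c′ b c (sym e))
    f-inj true  b c true  b′ c′ e = refl , h-inj e

module Metric (G : Graph) (connected : Connected G) where
  open Graph G

  d : V → V → ℕ
  d u v = proj₁ (connected u v)

  geodesic : ∀ u v → Walk _~_ u v (d u v)
  geodesic u v = proj₁ (proj₂ (connected u v))

  d-min : ∀ {u v n} → Walk _~_ u v n → d u v ≤ n
  d-min {u} {v} {n} W = proj₂ (proj₂ (connected u v)) n W

  Dist⇒≡d : ∀ {u v n} → Dist _~_ u v n → n ≡ d u v
  Dist⇒≡d (W , minimal) = ≤-antisym (minimal _ (geodesic _ _)) (d-min W)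

  ≡d⇒Dist : ∀ {u v n} → n ≡ d u v → Dist _~_ u v n
  ≡d⇒Dist refl = geodesic _ _ , λ _ → d-min

  d-sym : ∀ u v → d u v ≡ d v u
  d-sym u v = ≤-antisym (d-min (reverseʷ ~-sym (geodesic v u)))
                        (d-min (reverseʷ ~-sym (geodesic u v)))

  d-tri : ∀ u v w → d u w ≤ d u v + d v w
  d-tri u v w = d-min (geodesic u v ++ʷ geodesic v w)

  d≡0⇒≡ : ∀ {u v} → d u v ≡ 0 → u ≡ v
  d≡0⇒≡ {u} {v} e = walk-length-0 (subst (Walk _~_ u v) e (geodesic u v))

  ≡⇒d≡0 : ∀ {u v} → u ≡ v → d u v ≡ 0
  ≡⇒d≡0 {u} refl = ≤-antisym (d-min (nil {u = u})) z≤n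

  d≡1⇒~ : ∀ {u v} → d u v ≡ 1 → u ~ v
  d≡1⇒~ {u} {v} e = walk-length-1 (subst (Walk _~_ u v) e (geodesic u v))

  ~⇒d≡1 : ∀ {u v} → u ~ v → d u v ≡ 1
  ~⇒d≡1 {u} {v} e with d u v in eq | d-min (cons e nil)
  ... | zero  | _       = ⊥-elim (~-irref (subst (u ~_) (sym (d≡0⇒≡ eq)) e))
  ... | suc zero | _    = refl
  ... | suc (suc _) | s≤s ()

  -- equality of vertices is decidable: compare their distance with 0
  _≟ᵥ_ : ∀ u v → Dec (u ≡ v)
  u ≟ᵥ v with d u v in eq
  ... | zero  = yes (d≡0⇒≡ eq)
  ... | suc _ = no λ u≡v → 1+n≢0 (trans (sym eq) (≡⇒d≡0 u≡v))

  distinct⇒positive : ∀ {u v} → u ≢ v → Σ ℕ λ n → d u v ≡ suc n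
  distinct⇒positive {u} {v} u≢v with d u v in eq
  ... | zero  = ⊥-elim (u≢v (d≡0⇒≡ eq))
  ... | suc n = n , refl

  d-adjacent : ∀ {u v} → u ~ v → ∀ o → d u o ≤ suc (d v o)
  d-adjacent {u} {v} e o = subst (λ k → d u o ≤ k + d v o) (~⇒d≡1 e) (d-tri u v o)

  infix 4 _∈I⟨_,_⟩
  _∈I⟨_,_⟩ : V → V → V → Set
  w ∈I⟨ u , v ⟩ = d u w + d w v ≡ d u v

  end-∈I : ∀ {u v} → v ∈I⟨ u , v ⟩
  end-∈I {u} {v} = trans (cong (d u v +_) (≡⇒d≡0 refl)) (+-identityʳ (d u v))

  ∈I-sym : ∀ {u w v} → w ∈I⟨ u , v ⟩ → w ∈I⟨ v , u ⟩
  ∈I-sym {u} {w} {v} e = begin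
    d v w + d w u ≡⟨ cong₂ _+_ (d-sym v w) (d-sym w u) ⟩
    d w v + d u w ≡⟨ +-comm (d w v) (d u w) ⟩
    d u w + d w v ≡⟨ e ⟩
    d u v         ≡⟨ d-sym u v ⟩
    d v u         ∎
    where open ≡-Reasoning

  edge-toward : ∀ {u v o} → u ~ v → v ∈I⟨ u , o ⟩ → d u o ≡ suc (d v o)
  edge-toward {u} {v} {o} u~v v∈I = trans (sym v∈I) (cong (_+ d v o) (~⇒d≡1 u~v))

  Between⇒∈I : ∀ {u w v} → Between G u w v → w ∈I⟨ u , v ⟩
  Between⇒∈I (a , b , Da , Db , Dab) =
    trans (cong₂ _+_ (sym (Dist⇒≡d Da)) (sym (Dist⇒≡d Db))) (Dist⇒≡d Dab)

  ∈I⇒Between : ∀ {u w v} → w ∈I⟨ u , v ⟩ → Between G u w v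
  ∈I⇒Between {u} {w} {v} e = d u w , d w v , ≡d⇒Dist refl , ≡d⇒Dist refl , ≡d⇒Dist e

  first-step : ∀ {u v n} → d u v ≡ suc n → Σ V λ u′ → u ~ u′ × d u′ v ≡ n
  first-step {u} {v} {n} e with subst (Walk _~_ u v) e (geodesic u v)
  ... | cons {w = u′} u~u′ W =
    u′ , u~u′ , ≤-antisym (d-min W) (s≤s⁻¹ (subst (_≤ suc (d u′ v)) e (d-adjacent u~u′ v)))

  step-toward : ∀ {v m o n} → d v m ≡ suc n → m ∈I⟨ v , o ⟩ →
    Σ V λ v′ → v ~ v′ × d v′ m ≡ n × m ∈I⟨ v′ , o ⟩ × suc (d v′ o) ≡ d v o
  step-toward {v} {m} {o} {n} vm m∈I with first-step vm
  ... | v′ , v~v′ , v′m = v′ , v~v′ , v′m , trans (cong (_+ d m o) v′m) n+dmo≡dv′o ,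
                          trans (cong suc (sym n+dmo≡dv′o)) (trans (cong (_+ d m o) (sym vm)) m∈I)
    where
    upper : d v′ o ≤ n + d m o
    upper = subst (λ k → d v′ o ≤ k + d m o) v′m (d-tri v′ m o)
    lower : n + d m o ≤ d v′ o
    lower = s≤s⁻¹ (subst (_≤ suc (d v′ o)) (trans (sym m∈I) (cong (_+ d m o) vm)) (d-adjacent v~v′ o))
    n+dmo≡dv′o : n + d m o ≡ d v′ o
    n+dmo≡dv′o = ≤-antisym lower upper

  interval-lemma : ∀ {v a b c} → a ∈I⟨ v , c ⟩ → b ∈I⟨ a , c ⟩ → a ∈I⟨ v , b ⟩
  interval-lemma {v} {a} {b} {c} a∈I b∈I = ≤-antisym (+-cancelʳ-≤ (d b c) _ _ h) (d-tri v a b)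
    where
    h : d v a + d a b + d b c ≤ d v b + d b c
    h = subst (_≤ d v b + d b c)
          (trans (sym a∈I) (trans (cong (d v a +_) (sym b∈I)) (sym (+-assoc (d v a) (d a b) (d b c)))))
          (d-tri v b c)

  module ShortestWalk {R : V → V → Set} (R⇒~ : ∀ {a b} → R a b → a ~ b)
                      {w o} (W : Walk R w o (d w o)) where

    profile : ∀ i → d (vertex W i) o ≡ d w o ∸ toℕ i
    profile i = squeeze-∸ (d-min (mapʷ R⇒~ (prefix W i))) (d-min (mapʷ R⇒~ (suffix W i)))
                          (d-tri w (vertex W i) o)

    vertex-injective : Injective _≡_ _≡_ (vertex W)
    vertex-injective {i} {j} e = toℕ-injective (∸-cancelˡ-≡ (toℕ≤pred[n] i) (toℕ≤pred[n] j)
      (trans (sym (profile i)) (trans (cong (λ q → d q o) e) (profile j))))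

  Chain : ∀ n → (Fin (suc n) → V) → Set
  Chain n p = ∀ i → p (inject₁ i) ~ p (suc i)

  chain-tail : ∀ {n} p → Chain (suc n) p → Chain n (λ i → p (suc i))
  chain-tail p chain i = chain (suc i)

  chain-from-start : ∀ {n} p → Chain n p → ∀ j → d (p zero) (p j) ≤ toℕ j
  chain-from-start p chain zero = ≤-reflexive (≡⇒d≡0 refl)
  chain-from-start {suc n} p chain (suc j) = ≤-trans (d-tri (p zero) (p (suc zero)) (p (suc j)))
    (subst (λ k → k + d (p (suc zero)) (p (suc j)) ≤ suc (toℕ j)) (sym (~⇒d≡1 (chain zero)))
           (s≤s (chain-from-start (λ i → p (suc i)) (chain-tail p chain) j)))

  chain-segment : ∀ {n} p → Chain n p → ∀ i j → toℕ i ≤ toℕ j → d (p i) (p j) ≤ toℕ j ∸ toℕ i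
  chain-segment p chain zero j _ = chain-from-start p chain j
  chain-segment {suc n} p chain (suc i) (suc j) (s≤s i≤j) =
    chain-segment (λ k → p (suc k)) (chain-tail p chain) i j i≤j

  module GradedChain {n o} (p : Fin (suc n) → V) (chain : Chain n p)
                     (graded : ∀ i → d (p i) o ≡ n ∸ toℕ i) where

    distance : ∀ i j → toℕ i ≤ toℕ j → d (p i) (p j) ≡ toℕ j ∸ toℕ i
    distance i j i≤j = ≤-antisym (chain-segment p chain i j i≤j) (+-cancelʳ-≤ (n ∸ toℕ j) _ _ lower)
      where
      lower : (toℕ j ∸ toℕ i) + (n ∸ toℕ j) ≤ d (p i) (p j) + (n ∸ toℕ j)
      lower = subst₂ _≤_ (trans (graded i) (sym (∸-telescope i≤j (toℕ≤pred[n] j))))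
                         (cong (d (p i) (p j) +_) (graded j)) (d-tri (p i) (p j) o)

    toward-end : ∀ i j → toℕ i ≤ toℕ j → p j ∈I⟨ p i , o ⟩
    toward-end i j i≤j = begin
      d (p i) (p j) + d (p j) o         ≡⟨ cong₂ _+_ (distance i j i≤j) (graded j) ⟩
      (toℕ j ∸ toℕ i) + (n ∸ toℕ j)    ≡⟨ ∸-telescope i≤j (toℕ≤pred[n] j) ⟩
      n ∸ toℕ i                         ≡⟨ sym (graded i) ⟩
      d (p i) o                         ∎
      where open ≡-Reasoning

    toward-start : ∀ i j → toℕ j ≤ toℕ i → p j ∈I⟨ p i , p zero ⟩
    toward-start i j j≤i = begin
      d (p i) (p j) + d (p j) (p zero)  ≡⟨ cong₂ _+_ (trans (d-sym (p i) (p j)) (distance j i j≤i))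
                                                     (trans (d-sym (p j) (p zero)) (distance zero j z≤n)) ⟩
      (toℕ i ∸ toℕ j) + toℕ j          ≡⟨ m∸n+n≡m j≤i ⟩
      toℕ i                             ≡⟨ sym (trans (d-sym (p i) (p zero)) (distance zero i z≤n)) ⟩
      d (p i) (p zero)                  ∎
      where open ≡-Reasoning

module MedianGraph (G : Graph) (isMedian : Median G) where
  open Graph G
  open Metric G (proj₁ isMedian) public
  open Prism G

  median : V → V → V → V
  median a b c = proj₁ (proj₂ isMedian a b c)

  median-∈I₁ : ∀ a b c → median a b c ∈I⟨ a , b ⟩
  median-∈I₁ a b c = Between⇒∈I (proj₁ (proj₁ (proj₂ (proj₂ isMedian a b c))))

  median-∈I₂ : ∀ a b c → median a b c ∈I⟨ b , c ⟩
  median-∈I₂ a b c = Between⇒∈I (proj₁ (proj₂ (proj₁ (proj₂ (proj₂ isMedian a b c)))))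

  median-∈I₃ : ∀ a b c → median a b c ∈I⟨ c , a ⟩
  median-∈I₃ a b c = Between⇒∈I (proj₂ (proj₂ (proj₁ (proj₂ (proj₂ isMedian a b c)))))

  median-unique : ∀ {a b c m} → m ∈I⟨ a , b ⟩ → m ∈I⟨ b , c ⟩ → m ∈I⟨ c , a ⟩ → m ≡ median a b c
  median-unique {a} {b} {c} {m} m₁ m₂ m₃ =
    proj₂ (proj₂ (proj₂ isMedian a b c)) m (∈I⇒Between m₁ , ∈I⇒Between m₂ , ∈I⇒Between m₃)

  -- median graphs are bipartite: the ends of an edge have distances to any
  -- vertex o differing by exactly one (the median of u, v, o is u or v)
  edge-parity : ∀ {u v} → u ~ v → ∀ o → d v o ≡ suc (d u o) ⊎ d u o ≡ suc (d v o)
  edge-parity {u} {v} u~v o = cases (sum≡1 (d u m) (trans (median-∈I₁ u v o) (~⇒d≡1 u~v)))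
    where
    m : V
    m = median u v o
    cases : d u m ≡ 0 ⊎ d m v ≡ 0 → d v o ≡ suc (d u o) ⊎ d u o ≡ suc (d v o)
    cases (inj₁ um≡0) =
      inj₁ (edge-toward (~-sym u~v) (subst (_∈I⟨ v , o ⟩) (sym (d≡0⇒≡ um≡0)) (median-∈I₂ u v o)))
    cases (inj₂ mv≡0) =
      inj₂ (edge-toward u~v (subst (_∈I⟨ u , o ⟩) (d≡0⇒≡ mv≡0) (∈I-sym (median-∈I₃ u v o))))

  edge-descends : ∀ {v u o} → v ~ u → d u o ≤ d v o → suc (d u o) ≡ d v o
  edge-descends {v} {u} {o} v~u u≤v with edge-parity v~u o
  ... | inj₁ further = ⊥-elim (1+n≰n (subst (_≤ d v o) further u≤v))
  ... | inj₂ closer  = sym closer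

  two-apart : ∀ {b₁ a b₂ o} → b₁ ~ a → a ~ b₂ → b₁ ≢ b₂ → d b₁ o ≡ d b₂ o → d b₁ b₂ ≡ 2
  two-apart {b₁} {a} {b₂} {o} e₁ e₂ b₁≢b₂ same with d b₁ b₂ in eq | d-min (cons e₁ (cons e₂ nil))
  ... | zero              | _ = ⊥-elim (b₁≢b₂ (d≡0⇒≡ eq))
  ... | suc (suc zero)    | _ = refl
  ... | suc (suc (suc _)) | s≤s (s≤s ())
  ... | suc zero          | _ with edge-parity (d≡1⇒~ eq) o
  ...   | inj₁ further = ⊥-elim (1+n≢n (sym (trans same further)))
  ...   | inj₂ closer  = ⊥-elim (1+n≢n (sym (trans (sym same) closer)))

  -- quadrangle condition: two vertices at distance two and at equal distance
  -- from o have a common neighbour closer to o (their median with o)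
  quadrangle : ∀ {b₁ b₂ o} → d b₁ b₂ ≡ 2 → d b₁ o ≡ d b₂ o →
    Σ V λ t → b₁ ~ t × b₂ ~ t × suc (d t o) ≡ d b₁ o
  quadrangle {b₁} {b₂} {o} b₁b₂≡2 same = cases (sum≡2 (d b₁ c) (trans (median-∈I₁ b₁ b₂ o) b₁b₂≡2))
    where
    c : V
    c = median b₁ b₂ o
    c∈I⟨b₂,o⟩ : c ∈I⟨ b₂ , o ⟩
    c∈I⟨b₂,o⟩ = median-∈I₂ b₁ b₂ o
    cases : d b₁ c ≡ 0 ⊎ (d b₁ c ≡ 1 × d c b₂ ≡ 1) ⊎ d c b₂ ≡ 0 →
      Σ V λ t → b₁ ~ t × b₂ ~ t × suc (d t o) ≡ d b₁ o
    cases (inj₁ b₁c≡0) = ⊥-elim (n≢2+n (trans same (begin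
      d b₂ o              ≡⟨ sym c∈I⟨b₂,o⟩ ⟩
      d b₂ c + d c o      ≡⟨ cong (λ w → d b₂ w + d w o) (sym (d≡0⇒≡ b₁c≡0)) ⟩
      d b₂ b₁ + d b₁ o    ≡⟨ cong (_+ d b₁ o) (trans (d-sym b₂ b₁) b₁b₂≡2) ⟩
      suc (suc (d b₁ o))  ∎)))
      where open ≡-Reasoning
    cases (inj₂ (inj₂ cb₂≡0)) = ⊥-elim (n≢2+n (trans (sym same) (begin
      d b₁ o              ≡⟨ sym (∈I-sym (median-∈I₃ b₁ b₂ o)) ⟩
      d b₁ c + d c o      ≡⟨ cong (λ w → d b₁ w + d w o) (d≡0⇒≡ cb₂≡0) ⟩
      d b₁ b₂ + d b₂ o    ≡⟨ cong (_+ d b₂ o) b₁b₂≡2 ⟩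
      suc (suc (d b₂ o))  ∎)))
      where open ≡-Reasoning
    cases (inj₂ (inj₁ (b₁c≡1 , cb₂≡1))) =
      c , d≡1⇒~ b₁c≡1 , ~-sym (d≡1⇒~ cb₂≡1) ,
      trans (sym (edge-toward (~-sym (d≡1⇒~ cb₂≡1)) c∈I⟨b₂,o⟩)) (sym same)

  crossing-level : ∀ {x y u a} → u ~ a → d u y ≡ suc (d u x) → d a x ≡ suc (d a y) → d a y ≡ d u x
  crossing-level {x} {y} {u} {a} u~a uy ax = ≤-antisym
    (s≤s⁻¹ (subst₂ _≤_ ax refl (d-adjacent (~-sym u~a) x)))
    (s≤s⁻¹ (subst₂ _≤_ uy refl (d-adjacent u~a y)))

  -- For an edge xy, a vertex u closer to x than to y has at most one neighbour
  -- closer to y than to x: two such neighbours a ≠ b would have a common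
  -- neighbour c (quadrangle), and u and c would both be the median of a, b, x.
  unique-crossing : ∀ {x y u a b} → x ~ y → d u y ≡ suc (d u x) → u ~ a → u ~ b →
    d a x ≡ suc (d a y) → d b x ≡ suc (d b y) → a ≡ b
  unique-crossing {x} {y} {u} {a} {b} x~y uy u~a u~b ax bx with a ≟ᵥ b
  ... | yes a≡b = a≡b
  ... | no  a≢b = ⊥-elim (n≢2+n (begin
    d c y              ≡⟨ cong (λ w → d w y) (sym u≡c) ⟩
    d u y              ≡⟨ uy ⟩
    suc K              ≡⟨ cong suc (sym (trans cy ay)) ⟩
    suc (suc (d c y))  ∎))
    where
    open ≡-Reasoning
    K : ℕ
    K = d u x
    ay : d a y ≡ K
    ay = crossing-level u~a uy ax
    by : d b y ≡ K
    by = crossing-level u~b uy bx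
    ab≡2 : d a b ≡ 2
    ab≡2 = two-apart (~-sym u~a) u~b a≢b (trans ay (sym by))
    square : Σ V λ c → a ~ c × b ~ c × suc (d c y) ≡ d a y
    square = quadrangle ab≡2 (trans ay (sym by))
    c : V
    c = proj₁ square
    a~c : a ~ c
    a~c = proj₁ (proj₂ square)
    b~c : b ~ c
    b~c = proj₁ (proj₂ (proj₂ square))
    cy : suc (d c y) ≡ d a y
    cy = proj₂ (proj₂ (proj₂ square))
    cx : d c x ≡ K
    cx = ≤-antisym
      (subst (d c x ≤_)
             (trans (cong (d c y +_) (~⇒d≡1 (~-sym x~y))) (trans (+-comm (d c y) 1) (trans cy ay)))
             (d-tri c y x))
      (s≤s⁻¹ (subst (_≤ suc (d c x)) (trans ax (cong suc ay)) (d-adjacent a~c x)))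
    median-of-abx : ∀ {m} → a ~ m → m ~ b → d m x ≡ K → m ≡ median a b x
    median-of-abx {m} a~m m~b mx = median-unique
      (trans (cong₂ _+_ (~⇒d≡1 a~m) (~⇒d≡1 m~b)) (sym ab≡2))
      (trans (cong₂ _+_ (~⇒d≡1 (~-sym m~b)) mx) (sym (trans bx (cong suc by))))
      (trans (cong₂ _+_ (trans (d-sym x m) mx) (~⇒d≡1 (~-sym a~m)))
             (trans (+-comm K 1) (sym (trans (d-sym x a) (trans ax (cong suc ay))))))
    u≡c : u ≡ c
    u≡c = trans (median-of-abx (~-sym u~a) u~b refl) (sym (median-of-abx a~c (~-sym b~c) cx))

  module Fibers (z : V) where

    Star : V → Set
    Star = StarV G z

    fiber-∈I : ∀ {a v u} → Fiber G z a v → Star u → a ∈I⟨ v , u ⟩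
    fiber-∈I Fv su = Between⇒∈I (proj₂ Fv _ su)

    gate-unique : ∀ {a b v} → Fiber G z a v → Fiber G z b v → a ≡ b
    gate-unique {a} {b} {v} Fa Fb = d≡0⇒≡ (m+n≡0⇒m≡0 (d a b) (+-cancelˡ-≡ (d v a) _ _ round-trip))
      where
      open ≡-Reasoning
      round-trip : d v a + (d a b + d b a) ≡ d v a + 0
      round-trip = begin
        d v a + (d a b + d b a)  ≡⟨ sym (+-assoc (d v a) (d a b) (d b a)) ⟩
        d v a + d a b + d b a    ≡⟨ cong (_+ d b a) (fiber-∈I Fa (proj₁ Fb)) ⟩
        d v b + d b a            ≡⟨ fiber-∈I Fb (proj₁ Fa) ⟩
        d v a                    ≡⟨ sym (+-identityʳ (d v a)) ⟩
        d v a + 0                ∎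

    across : ∀ {a b v} → Fiber G z a v → Star b → d a b ≡ 1 → d v b ≡ suc (d v a)
    across {a} {b} {v} Fv sb ab≡1 =
      trans (sym (fiber-∈I Fv sb)) (trans (cong (d v a +_) ab≡1) (+-comm (d v a) 1))

    fiber-toward-gate : ∀ {a p q} → Fiber G z a p → p ~ q → suc (d q a) ≡ d p a → Fiber G z a q
    fiber-toward-gate {a} {p} {q} Fp p~q closer =
      proj₁ Fp , λ u su → ∈I⇒Between (≤-antisym (lower u su) (d-tri q a u))
      where
      lower : ∀ u → Star u → d q a + d a u ≤ d q u
      lower u su = s≤s⁻¹ (subst (_≤ suc (d q u))
        (trans (sym (fiber-∈I Fp su)) (cong (_+ d a u) (sym closer))) (d-adjacent p~q u))

    neighbouring-fibers : ∀ {x y v w} → Star y → y ≢ x → Fiber G z x v → Fiber G z y w → v ~ w →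
      d x y ≡ 1 × d v x ≡ d w y
    neighbouring-fibers {x} {y} {v} {w} sy y≢x Fv Fw v~w with d x y in xy
    ... | zero  = ⊥-elim (y≢x (sym (d≡0⇒≡ xy)))
    ... | suc e = cong suc (proj₁ bound) , proj₂ bound
      where
      bound : e ≡ 0 × d v x ≡ d w y
      bound = mutual-bound
        (subst (_≤ suc (d w y)) (trans (sym (fiber-∈I Fv sy)) (cong (d v x +_) xy))
               (d-adjacent v~w y))
        (subst (_≤ suc (d v x))
               (trans (sym (fiber-∈I Fw (proj₁ Fv))) (cong (d w y +_) (trans (d-sym y x) xy)))
               (d-adjacent (~-sym v~w) x))

    fiber-neighbour-unique : ∀ {x y u a b} → Star y → y ≢ x → Fiber G z x u →
      Fiber G z y a → Fiber G z y b → u ~ a → u ~ b → a ≡ b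
    fiber-neighbour-unique {x} {y} sy y≢x Fu Fa Fb u~a u~b =
      unique-crossing (d≡1⇒~ xy≡1) (across Fu sy xy≡1) u~a u~b
        (across Fa (proj₁ Fu) yx≡1) (across Fb (proj₁ Fu) yx≡1)
      where
      xy≡1 : d x y ≡ 1
      xy≡1 = proj₁ (neighbouring-fibers sy y≢x Fu Fa u~a)
      yx≡1 : d y x ≡ 1
      yx≡1 = trans (d-sym y x) xy≡1

    -- Let v ∈ F(x) have a neighbour w ∈ F(y).  A neighbour v′ of v closer to x
    -- lies in F(x) and has a neighbour t ∈ F(y) adjacent to w: t is the
    -- quadrangle vertex of v′ and w towards y.
    boundary-descends : ∀ {x y v w v′} → Star y → y ≢ x → Fiber G z x v → Fiber G z y w → v ~ w →
      v ~ v′ → suc (d v′ x) ≡ d v x → Fiber G z x v′ × Σ V λ t → Fiber G z y t × v′ ~ t × w ~ t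
    boundary-descends {x} {y} {v} {w} {v′} sy y≢x Fv Fw v~w v~v′ v′x =
      Fv′ , t , fiber-toward-gate Fw w~t (trans t-closer (sym wy≡v′y)) , v′~t , w~t
      where
      xy≡1 : d x y ≡ 1
      xy≡1 = proj₁ (neighbouring-fibers sy y≢x Fv Fw v~w)
      Fv′ : Fiber G z x v′
      Fv′ = fiber-toward-gate Fv v~v′ v′x
      wy≡v′y : d w y ≡ d v′ y
      wy≡v′y = trans (sym (proj₂ (neighbouring-fibers sy y≢x Fv Fw v~w)))
                     (trans (sym v′x) (sym (across Fv′ sy xy≡1)))
      v′≢w : v′ ≢ w
      v′≢w v′≡w = n≢2+n (trans (cong (λ q → d q x) v′≡w)
        (trans (across Fw (proj₁ Fv) (trans (d-sym y x) xy≡1))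
               (cong suc (trans wy≡v′y (across Fv′ sy xy≡1)))))
      square : Σ V λ t → v′ ~ t × w ~ t × suc (d t y) ≡ d v′ y
      square = quadrangle (two-apart (~-sym v~v′) v~w v′≢w (sym wy≡v′y)) (sym wy≡v′y)
      t : V
      t = proj₁ square
      v′~t : v′ ~ t
      v′~t = proj₁ (proj₂ square)
      w~t : w ~ t
      w~t = proj₁ (proj₂ (proj₂ square))
      t-closer : suc (d t y) ≡ d v′ y
      t-closer = proj₂ (proj₂ (proj₂ square))

    -- There is no prism of squares g ⊆ F(x), h ⊆ F(y) in a cube-free median
    -- graph whose bottom square g is graded towards x and whose two squares have
    -- distinct middle corners: grading passes to h along the rungs, making both
    -- squares injective, and disjoint fibers separate them.
    no-fiber-prism : CubeFree G → ∀ {x y k} → Star y → y ≢ x → (g h : Bool → Bool → V) →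
      (∀ b c → Fiber G z x (g b c)) → (∀ b c → Fiber G z y (h b c)) →
      IsSquare g → IsSquare h → (∀ b c → g b c ~ h b c) →
      (∀ b c → d (g b c) x + rank b c ≡ k) →
      g true false ≢ g false true → h true false ≢ h false true → ⊥
    no-fiber-prism cube-free {x} {y} {k} sy y≢x g h Fg Fh g-square h-square rung graded
                   g-middle h-middle =
      prism-not-cube-free g h g-square h-square rung
        (square-injective g (λ u → d u x) graded g-middle)
        (square-injective h (λ u → d u y) h-graded h-middle) disjoint cube-free
      where
      h-graded : ∀ b c → d (h b c) y + rank b c ≡ k
      h-graded b c = trans (cong (_+ rank b c) (sym rung-level)) (graded b c)
        where
        rung-level : d (g b c) x ≡ d (h b c) y
        rung-level = proj₂ (neighbouring-fibers sy y≢x (Fg b c) (Fh b c) (rung b c))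
      disjoint : ∀ b c b′ c′ → g b c ≢ h b′ c′
      disjoint b c b′ c′ e = y≢x (gate-unique (Fh b′ c′) (subst (Fiber G z x) e (Fg b c)))

    record PrismOver (x y p₁ p₂ q w : V) : Set where
      field
        Fp₁ : Fiber G z x p₁
        Fp₂ : Fiber G z x p₂
        Fq  : Fiber G z x q
        t₁ t₂ r : V
        Ft₁ : Fiber G z y t₁
        Ft₂ : Fiber G z y t₂
        Fr  : Fiber G z y r
        w~t₁ : w ~ t₁
        w~t₂ : w ~ t₂
        t₁~r : t₁ ~ r
        t₂~r : t₂ ~ r
        p₁~t₁ : p₁ ~ t₁
        p₂~t₂ : p₂ ~ t₂
        q~r   : q ~ r
        t₁≢t₂ : t₁ ≢ t₂

    -- A square v p₁ q p₂ descending towards x from v ∈ F(x), where v has a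
    -- neighbour w ∈ F(y), extends to a prism: boundary-descends pushes the edges
    -- vp₁, vp₂ and then p₁q, p₂q across to F(y), and the two pushes of q meet
    -- because q has only one neighbour in F(y).
    push-square : ∀ {x y v w p₁ p₂ q} → Star y → y ≢ x → Fiber G z x v → Fiber G z y w → v ~ w →
      v ~ p₁ → v ~ p₂ → p₁ ~ q → p₂ ~ q → p₁ ≢ p₂ →
      suc (d p₁ x) ≡ d v x → suc (d p₂ x) ≡ d v x → suc (d q x) ≡ d p₁ x → suc (d q x) ≡ d p₂ x →
      PrismOver x y p₁ p₂ q w
    push-square {x} {y} {p₂ = p₂} sy y≢x Fv Fw v~w v~p₁ v~p₂ p₁~q p₂~q p₁≢p₂ p₁x p₂x qp₁ qp₂
      with boundary-descends sy y≢x Fv Fw v~w v~p₁ p₁x | boundary-descends sy y≢x Fv Fw v~w v~p₂ p₂x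
    ... | Fp₁ , t₁ , Ft₁ , p₁~t₁ , w~t₁ | Fp₂ , t₂ , Ft₂ , p₂~t₂ , w~t₂
      with boundary-descends sy y≢x Fp₁ Ft₁ p₁~t₁ p₁~q qp₁ | boundary-descends sy y≢x Fp₂ Ft₂ p₂~t₂ p₂~q qp₂
    ... | Fq , r , Fr , q~r , t₁~r | _ , r′ , Fr′ , q~r′ , t₂~r′ = record
      { Fp₁ = Fp₁ ; Fp₂ = Fp₂ ; Fq = Fq ; t₁ = t₁ ; t₂ = t₂ ; r = r
      ; Ft₁ = Ft₁ ; Ft₂ = Ft₂ ; Fr = Fr ; w~t₁ = w~t₁ ; w~t₂ = w~t₂
      ; t₁~r = t₁~r ; t₂~r = subst (t₂ ~_) (sym r≡r′) t₂~r′
      ; p₁~t₁ = p₁~t₁ ; p₂~t₂ = p₂~t₂ ; q~r = q~r ; t₁≢t₂ = t₁≢t₂ }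
      where
      r≡r′ : r ≡ r′
      r≡r′ = fiber-neighbour-unique sy y≢x Fq Fr Fr′ q~r q~r′
      -- t₁ = t₂ would have the two neighbours p₁ ≠ p₂ in F(x)
      t₁≢t₂ : t₁ ≢ t₂
      t₁≢t₂ t₁≡t₂ = p₁≢p₂ (fiber-neighbour-unique (proj₁ Fv) (λ x≡y → y≢x (sym x≡y)) Ft₁ Fp₁ Fp₂
        (~-sym p₁~t₁) (subst (_~ p₂) (sym t₁≡t₂) (~-sym p₂~t₂)))

  module Boundary (cube-free : CubeFree G) (z x : V) where
    open Fibers z

    S : Subgraph G
    S = TotalBoundary G z x

    InBoundary : V → Set
    InBoundary = Subgraph.Vtx S

    E : V → V → Set
    E = Subgraph.Edg S

    -- Key lemma: a vertex v of S has at most one neighbour closer to x.  Two such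
    -- neighbours p₁ ≠ p₂ span a square v p₁ q p₂ in F(x) graded towards x; pushing
    -- it along v's neighbour w ∈ F(y) gives a prism, which is a forbidden 3-cube.
    unique-predecessor : ∀ {v p₁ p₂} → InBoundary v → v ~ p₁ → v ~ p₂ →
      suc (d p₁ x) ≡ d v x → suc (d p₂ x) ≡ d v x → p₁ ≡ p₂
    unique-predecessor {v} {p₁} {p₂} (y , (sy , y≢x) , Fv , w , Fw , v~w) v~p₁ v~p₂ p₁x p₂x
      with p₁ ≟ᵥ p₂
    ... | yes p₁≡p₂ = p₁≡p₂
    ... | no  p₁≢p₂ = ⊥-elim (no-fiber-prism cube-free sy y≢x g h Fg Fh
        ((λ { false → v~p₁ ; true → p₂~q }) , (λ { false → v~p₂ ; true → p₁~q }))
        ((λ { false → w~t₁ ; true → t₂~r }) , (λ { false → w~t₂ ; true → t₁~r }))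
        rung graded p₁≢p₂ t₁≢t₂)
      where
      p₁x≡p₂x : d p₁ x ≡ d p₂ x
      p₁x≡p₂x = suc-injective (trans p₁x (sym p₂x))
      square : Σ V λ q → p₁ ~ q × p₂ ~ q × suc (d q x) ≡ d p₁ x
      square = quadrangle (two-apart (~-sym v~p₁) v~p₂ p₁≢p₂ p₁x≡p₂x) p₁x≡p₂x
      q : V
      q = proj₁ square
      p₁~q : p₁ ~ q
      p₁~q = proj₁ (proj₂ square)
      p₂~q : p₂ ~ q
      p₂~q = proj₁ (proj₂ (proj₂ square))
      qx : suc (d q x) ≡ d p₁ x
      qx = proj₂ (proj₂ (proj₂ square))
      open PrismOver (push-square sy y≢x Fv Fw v~w v~p₁ v~p₂ p₁~q p₂~q p₁≢p₂ p₁x p₂x qx (trans qx p₁x≡p₂x))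
      g h : Bool → Bool → V
      g false false = v
      g true  false = p₁
      g false true  = p₂
      g true  true  = q
      h false false = w
      h true  false = t₁
      h false true  = t₂
      h true  true  = r
      Fg : ∀ b c → Fiber G z x (g b c)
      Fg false false = Fv
      Fg true  false = Fp₁
      Fg false true  = Fp₂
      Fg true  true  = Fq
      Fh : ∀ b c → Fiber G z y (h b c)
      Fh false false = Fw
      Fh true  false = Ft₁
      Fh false true  = Ft₂
      Fh true  true  = Fr
      rung : ∀ b c → g b c ~ h b c
      rung false false = v~w
      rung true  false = p₁~t₁
      rung false true  = p₂~t₂
      rung true  true  = q~r
      graded : ∀ b c → d (g b c) x + rank b c ≡ suc (suc (d q x))
      graded false false = trans (+-identityʳ (d v x)) (trans (sym p₁x) (cong suc (sym qx)))
      graded true  false = trans (+-comm (d p₁ x) 1) (cong suc (sym qx))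
      graded false true  = trans (+-comm (d p₂ x) 1) (cong suc (sym (trans qx p₁x≡p₂x)))
      graded true  true  = +-comm (d q x) 2

    E⇒~ : ∀ {u v} → E u v → u ~ v
    E⇒~ = proj₁

    E-sym : ∀ {u v} → E u v → E v u
    E-sym (u~v , y , o , bu , bv) = ~-sym u~v , y , o , bv , bu

    E-source : ∀ {u v} → E u v → InBoundary u
    E-source (_ , y , o , bu , _) = y , o , bu

    descend : ∀ n {y v m} → OtherFiber G z x y → BoundaryV G z x y v → d v m ≡ n → m ∈I⟨ v , x ⟩ →
      Walk E v m n × BoundaryV G z x y m
    descend zero o bv vm _ with d≡0⇒≡ vm
    ... | refl = nil , bv
    descend (suc n) {y} o bv@(Fv , w , Fw , v~w) vm m∈I with step-toward vm m∈I
    ... | v′ , v~v′ , v′m , m∈I′ , closer with boundary-descends (proj₁ o) (proj₂ o) Fv Fw v~w v~v′ closer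
    ... | Fv′ , t , Ft , v′~t , _ with descend n o (Fv′ , t , Ft , v′~t) v′m m∈I′
    ... | W , bm = cons (v~v′ , y , o , bv , (Fv′ , t , Ft , v′~t)) W , bm

    -- Two vertices u, v of S are joined inside S by a walk of length d u v:
    -- both descend within their boundary parts to the median of u, v and x.
    boundary-geodesic : ∀ {u v} → InBoundary u → InBoundary v → Walk E u v (d u v)
    boundary-geodesic {u} {v} (_ , ou , bu) (_ , ov , bv) =
      subst (Walk E u v) (trans (cong (d u m +_) (d-sym v m)) (median-∈I₁ u v x))
        (proj₁ (descend _ ou bu refl (∈I-sym (median-∈I₃ u v x))) ++ʷ
         reverseʷ E-sym (proj₁ (descend _ ov bv refl (median-∈I₂ u v x))))
      where
      m : V
      m = median u v x

    isometric : Isometric G S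
    isometric u v hu hv n = (λ D → ≡d⇒Dist (Dist-S⇒≡d D)) , (λ D → ≡d⇒Dist-S (Dist⇒≡d D))
      where
      Dist-S⇒≡d : ∀ {n} → Dist E u v n → n ≡ d u v
      Dist-S⇒≡d (W , minimal) = ≤-antisym (minimal _ (boundary-geodesic hu hv)) (d-min (mapʷ E⇒~ W))
      ≡d⇒Dist-S : ∀ {n} → n ≡ d u v → Dist E u v n
      ≡d⇒Dist-S refl = boundary-geodesic hu hv , λ _ W → d-min (mapʷ E⇒~ W)

    -- S has no cycle: the vertex of a cycle farthest from x would have two
    -- distinct cycle-neighbours closer to x
    acyclic : ¬ Cycle G S
    acyclic (k , c , c-inj , step , close) with argmax (λ i → d (c i) x)
    ... | j , farthest with cycle-neighbours {R = E} k c step close j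
    ... | a , b , aj , jb , a≢b = a≢b (c-inj (unique-predecessor (E-source jb)
      (~-sym (E⇒~ aj)) (E⇒~ jb)
      (edge-descends (~-sym (E⇒~ aj)) (farthest a)) (edge-descends (E⇒~ jb) (farthest b))))

    RootPath : ∀ n → (Fin (suc n) → V) → Set
    RootPath n p = Injective _≡_ _≡_ p × p (fromℕ n) ≡ x × (∀ i → E (p (inject₁ i)) (p (suc i)))

    root-path-tail : ∀ {n} p → RootPath (suc n) p → RootPath n (λ i → p (suc i))
    root-path-tail p (inj , end , step) = (λ e → fsuc-injective (inj e)) , end , (λ i → step (suc i))

    -- A root path cannot move away from x along its first edge: that would give
    -- the second vertex two predecessors (or put it at distance below zero).
    no-turn : ∀ {n} p → RootPath (suc n) p → (∀ i → d (p (suc i)) x ≡ n ∸ toℕ i) →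
      d (p (suc zero)) x ≡ suc (d (p zero) x) → ⊥
    no-turn {zero}  p _ tail-graded up = 1+n≢0 (trans (sym up) (tail-graded zero))
    no-turn {suc n} p (inj , _ , step) tail-graded up =
      0≢2 (inj (unique-predecessor (E-source (step (suc zero)))
        (~-sym (E⇒~ (step zero))) (E⇒~ (step (suc zero))) (sym up)
        (trans (cong suc (tail-graded (suc zero))) (sym (tail-graded zero)))))
      where
      0≢2 : zero {suc (suc n)} ≢ suc (suc zero)
      0≢2 ()

    root-path-head : ∀ {n} p → RootPath (suc n) p → (∀ i → d (p (suc i)) x ≡ n ∸ toℕ i) →
      d (p zero) x ≡ suc n
    root-path-head p rp@(_ , _ , step) tail-graded with edge-parity (E⇒~ (step zero)) x
    ... | inj₂ down = trans down (cong suc (tail-graded zero))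
    ... | inj₁ up   = ⊥-elim (no-turn p rp tail-graded up)

    root-path-graded : ∀ {n} p → RootPath n p → ∀ i → d (p i) x ≡ n ∸ toℕ i
    root-path-graded {zero}  p (_ , end , _) zero = ≡⇒d≡0 end
    root-path-graded {suc n} p rp zero    = root-path-head p rp (root-path-graded _ (root-path-tail p rp))
    root-path-graded {suc n} p rp (suc i) = root-path-graded _ (root-path-tail p rp) i

    -- every vertex on a geodesic from the start of a root path to x lies on it:
    -- its first step is the unique predecessor, which is the next path vertex
    root-path-covers : ∀ {n} p → RootPath n p → ∀ {a} → a ∈I⟨ p zero , x ⟩ →
      Σ (Fin (suc n)) λ i → p i ≡ a
    root-path-covers {zero} p (_ , end , _) {a} a∈I =
      zero , d≡0⇒≡ (m+n≡0⇒m≡0 (d (p zero) a) (trans a∈I (≡⇒d≡0 end)))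
    root-path-covers {suc n} p rp@(_ , _ , step) {a} a∈I with p zero ≟ᵥ a
    ... | yes p₀≡a = zero , p₀≡a
    ... | no  p₀≢a with step-toward (proj₂ (distinct⇒positive p₀≢a)) a∈I
    ... | w′ , p₀~w′ , _ , a∈I′ , closer =
      let (i , pi≡a) = root-path-covers _ (root-path-tail p rp) (subst (λ q → a ∈I⟨ q , x ⟩) w′≡p₁ a∈I′)
      in  suc i , pi≡a
      where
      graded : ∀ i → d (p i) x ≡ suc n ∸ toℕ i
      graded = root-path-graded p rp
      w′≡p₁ : w′ ≡ p (suc zero)
      w′≡p₁ = unique-predecessor (E-source (step zero)) p₀~w′ (E⇒~ (step zero)) closer
                (trans (cong suc (graded (suc zero))) (sym (graded zero)))

    -- every path of S from w to x is gated: the gate of v is the median of v, w, x,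
    -- which lies on the path, and the path is a geodesic towards both of its ends
    root-path-gated : ∀ {w} (P : PathIn G S w x) → Gated G (PathVtx G S P)
    root-path-gated (n , p , inj , _ , end , step) v =
      p i , (i , refl) , λ { u (j , refl) → ∈I⇒Between (gate-property j) }
      where
      rp : RootPath n p
      rp = inj , end , step
      open GradedChain p (λ k → E⇒~ (step k)) (root-path-graded p rp)
      m : V
      m = median v (p zero) x
      i : Fin (suc n)
      i = proj₁ (root-path-covers p rp (median-∈I₂ v (p zero) x))
      pi≡m : p i ≡ m
      pi≡m = proj₂ (root-path-covers p rp (median-∈I₂ v (p zero) x))
      gate-property : ∀ j → p i ∈I⟨ v , p j ⟩
      gate-property j with ≤-total (toℕ i) (toℕ j)
      ... | inj₁ i≤j = interval-lemma (subst (_∈I⟨ v , x ⟩) (sym pi≡m) (∈I-sym (median-∈I₃ v (p zero) x)))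
                                      (toward-end i j i≤j)
      ... | inj₂ j≤i = interval-lemma (subst (_∈I⟨ v , p zero ⟩) (sym pi≡m) (median-∈I₁ v (p zero) x))
                                      (toward-start i j j≤i)

    path-to-root : ∀ {w} → InBoundary w → PathIn G S w x
    path-to-root {w} (_ , o , bw) = d w x , vertex W , vertex-injective , refl , vertex-last W , vertex-step W
      where
      W : Walk E w x (d w x)
      W = proj₁ (descend (d w x) o bw refl end-∈I)
      open ShortestWalk E⇒~ W

lemma17 : (G : Graph) → Median G → CubeFree G →
    ∀ z x → StarV G z x →
    Isometric G (TotalBoundary G z x) × IsTree G (TotalBoundary G z x)
    × GatedBranches G (TotalBoundary G z x) x
lemma17 G isMedian cube-free z x _ =
  isometric , ((λ u v hu hv → d u v , boundary-geodesic hu hv) , acyclic) ,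
  λ w hw → path-to-root hw , root-path-gated
  where
  open MedianGraph G isMedian
  open Boundary cube-free z x
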